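{- Let $d\ge1$ and $q\ge3$ be integers, let $G$ be a connected $K_{1,d}$-free graph without induced cycles of length at least $q$, let $h\ge 2(d-1)(q-2)+2q$ be an integer, let $P$ be an induced path on at least $h$ vertices in $G$, and let $(B,\beta)$ be the $h$-backbone structure of $P$ in $G$. Then for every connected component $H$ of $G-N[V(P)]$ there exists $b_H\in V(B)$ such that $N(V(H))\subseteq\beta(b_H)$.
   Context: Graphs are finite and simple; $K_{1,d}$-free means no induced star with $d$ leaves. For a vertex set $X$, $N(X)$ is the set of vertices outside $X$ adjacent to some vertex of $X$, and $N[X]=X\cup N(X)$. For an induced path $P=v_1\dots v_\ell$ in $G$ with $\ell\ge h\ge1$, let $n=\ell-h+1$, let $B=b_1\dots b_n$ be a path, and for $i\in[n]$ let $P^i=v_iv_{i+1}\dots v_{i+h-1}$ and $\beta(b_i)=N_G[V(P^i)]$; the pair $(B,\beta)$ is the $h$-backbone structure of $P$ in $G$. -}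

module Defs where

open import Data.Nat using (ℕ; zero; suc; _+_; _≤_; _<_)
open import Data.Fin using (Fin; toℕ)
open import Data.Bool using (Bool; true)
open import Data.Product using (Σ; ∃; _×_)
open import Data.Sum using (_⊎_)
open import Relation.Nullary using (¬_)
open import Relation.Binary.PropositionalEquality using (_≡_)
open import Function.Definitions using (Injective)

record Graph (n : ℕ) : Set where
  field
    adj   : Fin n → Fin n → Bool
    sym   : ∀ u v → adj u v ≡ adj v u
    irrefl : ∀ v → ¬ (adj v v ≡ true)

open Graph public

Adj : ∀ {n} → Graph n → Fin n → Fin n → Set
Adj G u v = adj G u v ≡ true

VSet : ℕ → Set₁
VSet n = Fin n → Set

_⊆_ : ∀ {n} → VSet n → VSet n → Set
X ⊆ Y = ∀ v → X v → Y v

N : ∀ {n} → Graph n → VSet n → VSet n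
N G X v = ¬ X v × ∃ λ u → X u × Adj G u v

N[_] : ∀ {n} → Graph n → VSet n → VSet n
N[_] G X v = X v ⊎ N G X v

data WalkIn {n} (G : Graph n) (S : VSet n) : Fin n → Fin n → Set where
  here : ∀ {u} → S u → WalkIn G S u u
  step : ∀ {u v w} → S u → Adj G u v → WalkIn G S v w → WalkIn G S u w

ConnectedSet : ∀ {n} → Graph n → VSet n → Set
ConnectedSet G S = (∃ λ v → S v) × (∀ u v → S u → S v → WalkIn G S u v)

Connected : ∀ {n} → Graph n → Set
Connected G = ConnectedSet G (λ _ → ⊤')
  where open import Data.Unit using () renaming (⊤ to ⊤')

ComponentOfMinus : ∀ {n} → Graph n → VSet n → VSet n → Set₁
ComponentOfMinus G X H =
  (H ⊆ (λ v → ¬ X v)) × ConnectedSet G H ×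
  (∀ (H' : VSet _) → H ⊆ H' → H' ⊆ (λ v → ¬ X v) → ConnectedSet G H' → H' ⊆ H)

K1Free : ∀ {n} → ℕ → Graph n → Set
K1Free {n} d G =
  ¬ (Σ (Fin n) λ c → Σ (Fin d → Fin n) λ f →
       Injective _≡_ _≡_ f × (∀ i → Adj G c (f i)) ×
       (∀ i → ¬ f i ≡ c) ×
       (∀ i j → ¬ Adj G (f i) (f j)))

CycConsec : (k : ℕ) → Fin k → Fin k → Set
CycConsec k i j =
  (suc (toℕ i) ≡ toℕ j) ⊎ (suc (toℕ j) ≡ toℕ i) ⊎
  ((toℕ i ≡ 0 × suc (toℕ j) ≡ k) ⊎ (toℕ j ≡ 0 × suc (toℕ i) ≡ k))

InducedCycle : ∀ {n} → Graph n → (k : ℕ) → (Fin k → Fin n) → Set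
InducedCycle G k c =
  3 ≤ k × Injective _≡_ _≡_ c × (∀ i j → (Adj G (c i) (c j) → CycConsec k i j) × (CycConsec k i j → Adj G (c i) (c j)))

NoLongHoles : ∀ {n} → ℕ → Graph n → Set
NoLongHoles {n} q G = ∀ k → q ≤ k → (c : Fin k → Fin n) → ¬ InducedCycle G k c

PathConsec : ∀ {ℓ} → Fin ℓ → Fin ℓ → Set
PathConsec i j = (suc (toℕ i) ≡ toℕ j) ⊎ (suc (toℕ j) ≡ toℕ i)

-- induced path v_1 … v_ℓ (here indexed 0 … ℓ-1)
InducedPath : ∀ {n} → Graph n → (ℓ : ℕ) → (Fin ℓ → Fin n) → Set
InducedPath G ℓ p =
  Injective _≡_ _≡_ p × (∀ i j → (Adj G (p i) (p j) → PathConsec i j) × (PathConsec i j → Adj G (p i) (p j)))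

PathVerts : ∀ {n ℓ} → (Fin ℓ → Fin n) → VSet n
PathVerts {ℓ = ℓ} p v = ∃ λ (j : Fin ℓ) → p j ≡ v

-- V(P^i) for the window starting at (0-indexed) position i: v_i … v_{i+h-1}
Window : ∀ {n ℓ} → (Fin ℓ → Fin n) → ℕ → ℕ → VSet n
Window {ℓ = ℓ} p h i v = ∃ λ (j : Fin ℓ) → (i ≤ toℕ j) × (toℕ j < i + h) × (p j ≡ v)

-- h-backbone structure: B = b_0 … b_{ℓ-h} (index type Fin (ℓ ∸ h + 1)),
-- β(b_i) = N[V(P^i)]
β : ∀ {n ℓ} → Graph n → (Fin ℓ → Fin n) → (h : ℕ) → {m : ℕ} → Fin m → VSet n
β G p h i = N[ G ] (Window p h (toℕ i))

module Submission where

-- Let D = q - 2. If an off-path vertex x is adjacent to v f and v e, but to no vertex of P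
-- strictly between them, then x closes v f … v e into an induced cycle, so e - f ≤ D. Choosing
-- neighbours of x greedily, pairwise non-consecutive on P and each within D + 1 of the previous
-- one, K_{1,d}-freeness confines all neighbours of x to an interval of length 1 + (d - 1)(D + 1).
-- Any two vertices x, y of N(H) are joined by a walk through H, which avoids N[V(P)]; together
-- with the part of P between a neighbour of x and the next neighbour of y it again yields an
-- induced cycle, so x and y have neighbours on P at distance at most D. Fixing x and its first
-- neighbour α on P, every vertex of N(H) therefore has a neighbour in
-- [α - D, α + 1 + (d - 1)(D + 1) + D], and h ≥ 2(d - 1)(q - 2) + 2q makes this interval fit
-- into one window P^i.

open import Defs hiding (sym)
open import Data.Nat using (ℕ; zero; suc; _+_; _*_; _∸_; _≤_; _<_; _≤?_; _<?_; _≟_; z≤n; s≤s; s≤s⁻¹; z<s)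
open import Data.Nat.Properties
open import Data.Nat.Induction using (<-wellFounded)
open import Data.Nat.Tactic.RingSolver using (solve-∀)
open import Data.Fin using (Fin; toℕ; fromℕ<) renaming (_≟_ to _≟ᶠ_)
open import Data.Fin.Properties using (toℕ-injective; toℕ<n; toℕ-fromℕ<; fromℕ<-toℕ; any?)
open import Data.Bool using (true) renaming (_≟_ to _≟ᵇ_)
open import Data.Product using (Σ; ∃; ∃₂; _×_; _,_; proj₁; proj₂)
open import Data.Sum using (_⊎_; inj₁; inj₂; map₂) renaming (map to ⊎-map)
open import Data.Unit using (tt)
open import Data.Empty using (⊥-elim)
open import Induction.WellFounded using (Acc; acc)
open import Relation.Nullary using (¬_; Dec; yes; no)
open import Relation.Nullary.Decidable using (_⊎-dec_; _×-dec_; ¬?)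
open import Relation.Binary.Definitions using (tri<; tri≈; tri>)
open import Relation.Binary.PropositionalEquality

module _ {P : ℕ → Set} (P? : ∀ k → Dec (P k)) where

  greatest-in : ∀ {lo hi} → lo ≤ hi → P lo →
    ∃ λ e → lo ≤ e × e ≤ hi × P e × (∀ t → e < t → t ≤ hi → ¬ P t)
  greatest-in {lo} {hi} lo≤hi Plo with P? hi
  ... | yes Phi = hi , lo≤hi , ≤-refl , Phi , λ t hi<t t≤hi _ → <⇒≱ hi<t t≤hi
  greatest-in {hi = zero} z≤n Plo | no ¬Phi = ⊥-elim (¬Phi Plo)
  greatest-in {hi = suc hi} lo≤hi Plo | no ¬Phi with m≤n⇒m<n∨m≡n lo≤hi
  ... | inj₂ refl = ⊥-elim (¬Phi Plo)
  ... | inj₁ lo<hi with greatest-in (s≤s⁻¹ lo<hi) Plo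
  ...   | e , lo≤e , e≤hi , Pe , above = e , lo≤e , m≤n⇒m≤1+n e≤hi , Pe , above′
    where
    above′ : ∀ t → e < t → t ≤ suc hi → ¬ P t
    above′ t e<t t≤ with m≤n⇒m<n∨m≡n t≤
    ... | inj₁ t≤hi = above t e<t (s≤s⁻¹ t≤hi)
    ... | inj₂ refl = ¬Phi

  least-in : ∀ {lo hi} → lo ≤ hi → P hi →
    ∃ λ e → lo ≤ e × e ≤ hi × P e × (∀ t → lo ≤ t → t < e → ¬ P t)
  least-in lo≤hi Phi with m≤n⇒∃[o]m+o≡n lo≤hi
  ... | g , refl = least-from g Phi
    where
    least-from : ∀ g {lo} → P (lo + g) →
      ∃ λ e → lo ≤ e × e ≤ lo + g × P e × (∀ t → lo ≤ t → t < e → ¬ P t)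
    least-from g {lo} P[lo+g] with P? lo
    ... | yes Plo = lo , ≤-refl , m≤m+n lo g , Plo , λ t lo≤t t<lo _ → <⇒≱ t<lo lo≤t
    least-from zero {lo} P[lo+0] | no ¬Plo = ⊥-elim (¬Plo (subst P (+-identityʳ lo) P[lo+0]))
    least-from (suc g) {lo} P[lo+1+g] | no ¬Plo with least-from g (subst P (+-suc lo g) P[lo+1+g])
    ... | e , lo<e , e≤ , Pe , below = e , <⇒≤ lo<e , subst (e ≤_) (sym (+-suc lo g)) e≤ , Pe , below′
      where
      below′ : ∀ t → lo ≤ t → t < e → ¬ P t
      below′ t lo≤t t<e with m≤n⇒m<n∨m≡n lo≤t
      ... | inj₁ lo<t = below t lo<t t<e
      ... | inj₂ refl = ¬Plo

module _ {n : ℕ} (G : Graph n) where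

  Adj-sym : ∀ {u v} → Adj G u v → Adj G v u
  Adj-sym {u} {v} e = trans (Graph.sym G v u) e

  adj? : ∀ u v → Dec (Adj G u v)
  adj? u v = adj G u v ≟ᵇ true

  map-walk : ∀ {S S′ u v} → S ⊆ S′ → WalkIn G S u v → WalkIn G S′ u v
  map-walk f (here s) = here (f _ s)
  map-walk f (step s e w) = step (f _ s) e (map-walk f w)

  walk-end : ∀ {S u v} → WalkIn G S u v → S v
  walk-end (here s) = s
  walk-end (step _ _ w) = walk-end w

  append-walk : ∀ {S u v w} → WalkIn G S u v → WalkIn G S v w → WalkIn G S u w
  append-walk (here _) w = w
  append-walk (step s e w₁) w₂ = step s e (append-walk w₁ w₂)

  snoc-walk : ∀ {S u v w} → WalkIn G S u v → Adj G v w → S w → WalkIn G S u w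
  snoc-walk w e s = append-walk w (step (walk-end w) e (here s))

  reverse-walk : ∀ {S u v} → WalkIn G S u v → WalkIn G S v u
  reverse-walk (here s) = here s
  reverse-walk (step s e w) = snoc-walk (reverse-walk w) (Adj-sym e) s

  -- Walks as sequences on ℕ, so that cutting out a segment is a reindexing.
  record Walk (T : VSet n) (x y : Fin n) : Set where
    field
      len    : ℕ
      at     : ℕ → Fin n
      at-0   : at 0 ≡ x
      at-len : at len ≡ y
      steps  : ∀ t → t < len → Adj G (at t) (at (suc t))
      inner  : ∀ t → 0 < t → t < len → T (at t)

  edge-walk : ∀ {T x y} → Adj G x y → Walk T x y
  edge-walk {x = x} {y} e = record
    { len = 1 ; at = λ { zero → x ; (suc _) → y } ; at-0 = refl ; at-len = refl
    ; steps = λ { zero _ → e ; (suc _) (s≤s ()) } ; inner = λ { (suc _) _ (s≤s ()) } }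

  cons-walk : ∀ {T x u y} → Adj G x u → T u → Walk T u y → Walk T x y
  cons-walk {T} {x} e Tu w = record
    { len = suc len ; at = at′ ; at-0 = refl ; at-len = at-len ; steps = steps′ ; inner = inner′ }
    where
    open Walk w
    at′ : ℕ → Fin n
    at′ zero = x
    at′ (suc t) = at t
    steps′ : ∀ t → t < suc len → Adj G (at′ t) (at′ (suc t))
    steps′ zero _ = subst (Adj G x) (sym at-0) e
    steps′ (suc t) t< = steps t (s≤s⁻¹ t<)
    inner′ : ∀ t → 0 < t → t < suc len → T (at′ t)
    inner′ (suc zero) _ _ = subst T (sym at-0) Tu
    inner′ (suc (suc t)) _ t< = inner (suc t) z<s (s≤s⁻¹ t<)

  toWalk : ∀ {T x u v y} → Adj G x u → WalkIn G T u v → Adj G v y → Walk T x y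
  toWalk e (here Tu) e′ = cons-walk e Tu (edge-walk e′)
  toWalk e (step Tu e₁ w) e′ = cons-walk e Tu (toWalk e₁ w e′)

  record IsInducedPath (L : ℕ) (f : ℕ → Fin n) : Set where
    field
      adjacent  : ∀ k → suc k < L → Adj G (f k) (f (suc k))
      injective : ∀ i j → i < L → j < L → f i ≡ f j → i ≡ j
      chordless : ∀ i j → i < L → j < L → Adj G (f i) (f j) → suc i ≡ j ⊎ suc j ≡ i

  IsInducedPath-drop : ∀ {L f} → IsInducedPath L f → ∀ i {L′} → i + L′ ≤ L →
    IsInducedPath L′ (λ s → f (i + s))
  IsInducedPath-drop {L} {f} f-path i {L′} i+L′≤L = record
    { adjacent = λ k k< → subst (λ z → Adj G (f (i + k)) (f z)) (sym (+-suc i k))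
                                (adjacent (i + k) (subst (_< L) (+-suc i k) (shift k<)))
    ; injective = λ a b a< b< e → +-cancelˡ-≡ i a b (injective _ _ (shift a<) (shift b<) e)
    ; chordless = λ a b a< b< e → ⊎-map (cancel a b) (cancel b a) (chordless _ _ (shift a<) (shift b<) e) }
    where
    open IsInducedPath f-path
    shift : ∀ {s} → s < L′ → i + s < L
    shift s< = <-≤-trans (+-monoʳ-< i s<) i+L′≤L
    cancel : ∀ a b → suc (i + a) ≡ i + b → suc a ≡ b
    cancel a b e = +-cancelˡ-≡ i (suc a) b (trans (+-suc i a) e)

  -- Under this condition, deleting positions c, …, c + g - 1 of a walk from x leaves a walk from x.
  Rejoins : (ℕ → Fin n) → Fin n → ℕ → ℕ → Set
  Rejoins f x zero g = f g ≡ x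
  Rejoins f x (suc c) g = Adj G (f c) (f (suc c + g))

  excise : ∀ {T x y} (w : Walk T x y) {c g m} → Walk.len w ≡ m + g → c ≤ m →
    Rejoins (Walk.at w) x c g → Σ (Walk T x y) λ w′ → Walk.len w′ ≡ m
  excise {T} {x} {y} w {c} {g} {m} len≡ c≤m rejoins =
    record { len = m ; at = at′ ; at-0 = at′-0 ; at-len = at′-m ; steps = steps′ ; inner = inner′ } , refl
    where
    open Walk w
    at′ : ℕ → Fin n
    at′ t with t <? c
    ... | yes _ = at t
    ... | no _ = at (t + g)
    <m⇒<len : ∀ {t} → t < m → t < len
    <m⇒<len t<m = <-≤-trans t<m (subst (m ≤_) (sym len≡) (m≤m+n m g))
    +g<len : ∀ {t} → t < m → t + g < len
    +g<len t<m = subst (_ <_) (sym len≡) (+-monoˡ-< g t<m)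
    seam : ∀ c → Rejoins at x c g → ∀ t → suc t ≡ c → Adj G (at t) (at (suc t + g))
    seam (suc c) rejoins t refl = rejoins
    at′-0 : at′ 0 ≡ x
    at′-0 with 0 <? c
    ... | yes _ = at-0
    ... | no 0≮c = start c 0≮c rejoins
      where
      start : ∀ c → ¬ 0 < c → Rejoins at x c g → at g ≡ x
      start zero _ at-g≡x = at-g≡x
      start (suc _) 0≮c _ = ⊥-elim (0≮c z<s)
    at′-m : at′ m ≡ y
    at′-m with m <? c
    ... | yes m<c = ⊥-elim (<⇒≱ m<c c≤m)
    ... | no _ = trans (cong at (sym len≡)) at-len
    steps′ : ∀ t → t < m → Adj G (at′ t) (at′ (suc t))
    steps′ t t<m with t <? c | suc t <? c
    ... | yes _ | yes t+1<c = steps t (<m⇒<len (<-≤-trans (n<1+n t) (<⇒≤ (<-≤-trans t+1<c c≤m))))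
    ... | yes t<c | no t+1≮c = seam c rejoins t (≤-antisym t<c (≮⇒≥ t+1≮c))
    ... | no t≮c | yes t+1<c = ⊥-elim (t≮c (<-trans (n<1+n t) t+1<c))
    ... | no _ | no _ = steps (t + g) (+g<len t<m)
    inner′ : ∀ t → 0 < t → t < m → T (at′ t)
    inner′ t 0<t t<m with t <? c
    ... | yes _ = inner t 0<t (<m⇒<len t<m)
    ... | no _ = inner (t + g) (<-≤-trans 0<t (m≤m+n t g)) (+g<len t<m)

  Chord : ℕ → (ℕ → Fin n) → Set
  Chord m f = ∃ λ j → j < suc m × ∃ λ i → i < j × (f i ≡ f j ⊎ (suc i < j × Adj G (f i) (f j)))

  chord? : ∀ m f → Dec (Chord m f)
  chord? m f = anyUpTo? (λ j → anyUpTo? (λ i → chord-at? i j) j) (suc m)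
    where
    chord-at? : ∀ i j → Dec (f i ≡ f j ⊎ (suc i < j × Adj G (f i) (f j)))
    chord-at? i j = (f i ≟ᶠ f j) ⊎-dec ((suc i <? j) ×-dec adj? (f i) (f j))

  repeat-rejoins : ∀ {T x y} (w : Walk T x y) i g → suc i + g ≤ Walk.len w →
    Walk.at w i ≡ Walk.at w (suc i + g) → Rejoins (Walk.at w) x i (suc g)
  repeat-rejoins w zero g _ repeat = trans (sym repeat) (Walk.at-0 w)
  repeat-rejoins w (suc i) g bound repeat =
    subst (Adj G (at i)) (trans repeat (cong (λ z → at (suc z)) (sym (+-suc i g))))
      (steps i (≤-trans (s≤s (m≤n⇒m≤1+n (m≤m+n i g))) bound))
    where open Walk w

  remove-chord : ∀ {T x y} (w : Walk T x y) → Chord (Walk.len w) (Walk.at w) →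
    Σ (Walk T x y) λ w′ → Walk.len w′ < Walk.len w
  remove-chord {T} {x} {y} w (j , j≤len , i , i<j , chord)
    with m≤n⇒∃[o]m+o≡n i<j | m≤n⇒∃[o]m+o≡n (s≤s⁻¹ j≤len)
  ... | g , refl | r , j+r≡len = shortcut chord
    where
    open Walk w
    shorter : ∀ {m g} → (Σ (Walk T x y) λ w′ → Walk.len w′ ≡ m) → 0 < g → len ≡ m + g →
      Σ (Walk T x y) λ w′ → Walk.len w′ < len
    shorter (w′ , refl) 0<g len≡ = w′ , subst (_ <_) (sym len≡) (m<m+n _ 0<g)
    shortcut : at i ≡ at (suc i + g) ⊎ (suc i < suc i + g × Adj G (at i) (at (suc i + g))) →
      Σ (Walk T x y) λ w′ → Walk.len w′ < len
    shortcut (inj₁ repeat) =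
      shorter (excise w len≡ (m≤m+n i r) (repeat-rejoins w i g (s≤s⁻¹ j≤len) repeat)) z<s len≡
      where
      len≡ : len ≡ i + r + suc g
      len≡ = trans (sym j+r≡len) (regroup i g r)
        where
        regroup : ∀ i g r → suc i + g + r ≡ i + r + suc g
        regroup = solve-∀
    shortcut (inj₂ (i+1<j , chord)) = shorter (excise w len≡ (m≤m+n (suc i) r) chord) 0<g len≡
      where
      0<g : 0 < g
      0<g = +-cancelˡ-< (suc i) 0 g (subst (_< suc i + g) (sym (+-identityʳ (suc i))) i+1<j)
      len≡ : len ≡ suc i + r + g
      len≡ = trans (sym j+r≡len) (regroup i g r)
        where
        regroup : ∀ i g r → suc i + g + r ≡ suc i + r + g
        regroup = solve-∀

  chordless-walk : ∀ {T x y} (w : Walk T x y) → ¬ Chord (Walk.len w) (Walk.at w) →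
    IsInducedPath (suc (Walk.len w)) (Walk.at w)
  chordless-walk w no-chord = record
    { adjacent = λ k k< → steps k (s≤s⁻¹ k<) ; injective = injective ; chordless = chordless }
    where
    open Walk w
    injective : ∀ i j → i < suc len → j < suc len → at i ≡ at j → i ≡ j
    injective i j i< j< e with <-cmp i j
    ... | tri< i<j _ _ = ⊥-elim (no-chord (j , j< , i , i<j , inj₁ e))
    ... | tri≈ _ i≡j _ = i≡j
    ... | tri> _ _ j<i = ⊥-elim (no-chord (i , i< , j , j<i , inj₁ (sym e)))
    chordless : ∀ i j → i < suc len → j < suc len → Adj G (at i) (at j) → suc i ≡ j ⊎ suc j ≡ i
    chordless i j i< j< e with <-cmp i j
    ... | tri≈ _ refl _ = ⊥-elim (irrefl G (at i) e)
    ... | tri< i<j _ _ with suc i <? j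
    ...   | yes i+1<j = ⊥-elim (no-chord (j , j< , i , i<j , inj₂ (i+1<j , e)))
    ...   | no i+1≮j = inj₁ (≤-antisym i<j (≮⇒≥ i+1≮j))
    chordless i j i< j< e | tri> _ _ j<i with suc j <? i
    ...   | yes j+1<i = ⊥-elim (no-chord (i , i< , j , j<i , inj₂ (j+1<i , Adj-sym e)))
    ...   | no j+1≮i = inj₂ (≤-antisym j<i (≮⇒≥ j+1≮i))

  induced-subwalk : ∀ {T x y} (w : Walk T x y) →
    Σ (Walk T x y) λ w′ → IsInducedPath (suc (Walk.len w′)) (Walk.at w′)
  induced-subwalk w = go w (<-wellFounded (Walk.len w))
    where
    go : ∀ {T x y} (w : Walk T x y) → Acc _<_ (Walk.len w) →
      Σ (Walk T x y) λ w′ → IsInducedPath (suc (Walk.len w′)) (Walk.at w′)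
    go w (acc shorter) with chord? (Walk.len w) (Walk.at w)
    ... | no no-chord = w , chordless-walk w no-chord
    ... | yes chord = let w′ , w′<w = remove-chord w chord in go w′ (shorter w′<w)

  CyclicNeighbours : ℕ → ℕ → ℕ → Set
  CyclicNeighbours L i j = suc i ≡ j ⊎ suc j ≡ i ⊎ ((i ≡ 0 × suc j ≡ L) ⊎ (j ≡ 0 × suc i ≡ L))

  CyclicNeighbours-sym : ∀ {L i j} → CyclicNeighbours L i j → CyclicNeighbours L j i
  CyclicNeighbours-sym (inj₁ e) = inj₂ (inj₁ e)
  CyclicNeighbours-sym (inj₂ (inj₁ e)) = inj₁ e
  CyclicNeighbours-sym (inj₂ (inj₂ (inj₁ e))) = inj₂ (inj₂ (inj₂ e))
  CyclicNeighbours-sym (inj₂ (inj₂ (inj₂ e))) = inj₂ (inj₂ (inj₁ e))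

  -- The cycle b 0, …, b δ = a 0, a 1, …, a (m - 1), closed by a m = b 0.
  module GluedCycle {δ m : ℕ} {b a : ℕ → Fin n}
    (b-path : IsInducedPath (suc δ) b) (a-path : IsInducedPath (suc m) a)
    (2≤δ : 2 ≤ δ) (a-0 : a 0 ≡ b δ) (a-m : a m ≡ b 0)
    (apart : ∀ t → 0 < t → t < m → ∀ s → 0 < s → s < δ → a t ≢ b s × ¬ Adj G (a t) (b s)) where

    private
      module A = IsInducedPath a-path
      module B = IsInducedPath b-path

    m≢0 : m ≢ 0
    m≢0 refl = m<n⇒n≢0 2≤δ (B.injective δ 0 ≤-refl z<s (trans (sym a-0) a-m))

    m≢1 : m ≢ 1
    m≢1 refl with B.chordless δ 0 ≤-refl z<s (subst₂ (Adj G) a-0 a-m (A.adjacent 0 ≤-refl))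
    ... | inj₂ 1≡δ = <⇒≢ 2≤δ 1≡δ

    2≤m : 2 ≤ m
    2≤m = at-least-2 m≢0 m≢1
      where
      at-least-2 : ∀ {k} → k ≢ 0 → k ≢ 1 → 2 ≤ k
      at-least-2 {zero} k≢0 _ = ⊥-elim (k≢0 refl)
      at-least-2 {suc zero} _ k≢1 = ⊥-elim (k≢1 refl)
      at-least-2 {suc (suc _)} _ _ = s≤s (s≤s z≤n)

    L : ℕ
    L = δ + m

    vertex : ℕ → Fin n
    vertex s with s ≤? δ
    ... | yes _ = b s
    ... | no _ = a (s ∸ δ)

    vertex-b : ∀ {s} → s ≤ δ → vertex s ≡ b s
    vertex-b {s} s≤δ with s ≤? δ
    ... | yes _ = refl
    ... | no s≰δ = ⊥-elim (s≰δ s≤δ)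

    vertex-a : ∀ u → vertex (δ + suc u) ≡ a (suc u)
    vertex-a u with δ + suc u ≤? δ
    ... | yes δ+1+u≤δ = ⊥-elim (<⇒≱ (m<m+n δ z<s) δ+1+u≤δ)
    ... | no _ = cong a (m+n∸m≡n δ (suc u))

    data Side : ℕ → Set where
      on-b : ∀ {s} → s ≤ δ → Side s
      on-a : ∀ u → Side (δ + suc u)

    side : ∀ s → Side s
    side s with s ≤? δ
    ... | yes s≤δ = on-b s≤δ
    ... | no s≰δ with m≤n⇒∃[o]m+o≡n (≰⇒> s≰δ)
    ...   | u , refl = subst Side (+-suc δ u) (on-a u)

    inner-a : ∀ {u} → δ + suc u < L → suc u < m
    inner-a {u} = +-cancelˡ-< δ (suc u) m

    δ+1<L : suc δ < L
    δ+1<L = subst (_≤ L) (+-comm δ 2) (+-monoʳ-≤ δ 2≤m)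

    b-inner-apart : ∀ {s u} → s ≤ δ → s ≢ 0 → s ≢ δ → suc u < m →
      a (suc u) ≢ b s × ¬ Adj G (a (suc u)) (b s)
    b-inner-apart s≤δ s≢0 s≢δ u<m = apart _ z<s u<m _ (n≢0⇒n>0 s≢0) (≤∧≢⇒< s≤δ s≢δ)

    b≢a : ∀ {s u} → s ≤ δ → suc u < m → b s ≢ a (suc u)
    b≢a {s} {u} s≤δ u<m e with s ≟ 0 | s ≟ δ
    ... | yes refl | _ = <⇒≢ u<m (sym (A.injective m (suc u) ≤-refl (m<n⇒m<1+n u<m) (trans a-m e)))
    ... | no _ | yes refl = 0≢1+n (A.injective 0 (suc u) z<s (m<n⇒m<1+n u<m) (trans a-0 e))
    ... | no s≢0 | no s≢δ = proj₁ (b-inner-apart s≤δ s≢0 s≢δ u<m) (sym e)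

    b∼a : ∀ {s u} → s ≤ δ → suc u < m → Adj G (b s) (a (suc u)) →
      (s ≡ 0 × suc (suc u) ≡ m) ⊎ (s ≡ δ × u ≡ 0)
    b∼a {s} {u} s≤δ u<m e with s ≟ 0 | s ≟ δ
    ... | yes refl | _
      with A.chordless m (suc u) ≤-refl (m<n⇒m<1+n u<m) (subst (λ z → Adj G z (a (suc u))) (sym a-m) e)
    ...   | inj₁ m+1≡u+1 = ⊥-elim (<⇒≢ (<-trans (n<1+n u) u<m) (sym (suc-injective m+1≡u+1)))
    ...   | inj₂ u+2≡m = inj₁ (refl , u+2≡m)
    b∼a {s} {u} s≤δ u<m e | no _ | yes refl
      with A.chordless 0 (suc u) z<s (m<n⇒m<1+n u<m) (subst (λ z → Adj G z (a (suc u))) (sym a-0) e)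
    ...   | inj₁ 1≡u+1 = inj₂ (refl , sym (suc-injective 1≡u+1))
    b∼a s≤δ u<m e | no s≢0 | no s≢δ = ⊥-elim (proj₂ (b-inner-apart s≤δ s≢0 s≢δ u<m) (Adj-sym e))

    injective : ∀ i j → i < L → j < L → vertex i ≡ vertex j → i ≡ j
    injective i j i<L j<L e with side i | side j
    ... | on-b i≤δ | on-b j≤δ =
      B.injective i j (s≤s i≤δ) (s≤s j≤δ) (trans (sym (vertex-b i≤δ)) (trans e (vertex-b j≤δ)))
    ... | on-b i≤δ | on-a u =
      ⊥-elim (b≢a i≤δ (inner-a j<L) (trans (sym (vertex-b i≤δ)) (trans e (vertex-a u))))
    ... | on-a u | on-b j≤δ =
      ⊥-elim (b≢a j≤δ (inner-a i<L) (trans (sym (vertex-b j≤δ)) (trans (sym e) (vertex-a u))))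
    ... | on-a u | on-a u′ =
      cong (δ +_) (A.injective (suc u) (suc u′) (m<n⇒m<1+n (inner-a i<L)) (m<n⇒m<1+n (inner-a j<L))
                                (trans (sym (vertex-a u)) (trans e (vertex-a u′))))

    b-a-cyclic : ∀ {s u} → s ≤ δ → δ + suc u < L →
      Adj G (vertex s) (vertex (δ + suc u)) → CyclicNeighbours L s (δ + suc u)
    b-a-cyclic {u = u} s≤δ j<L e with b∼a s≤δ (inner-a j<L) (subst₂ (Adj G) (vertex-b s≤δ) (vertex-a u) e)
    ... | inj₁ (refl , u+2≡m) = inj₂ (inj₂ (inj₁ (refl , trans (sym (+-suc δ (suc u))) (cong (δ +_) u+2≡m))))
    ... | inj₂ (refl , refl) = inj₁ (sym (trans (+-suc δ 0) (cong suc (+-identityʳ δ))))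

    adj⇒cyclic : ∀ i j → i < L → j < L → Adj G (vertex i) (vertex j) → CyclicNeighbours L i j
    adj⇒cyclic i j i<L j<L e with side i | side j
    ... | on-b i≤δ | on-b j≤δ =
      map₂ inj₁ (B.chordless i j (s≤s i≤δ) (s≤s j≤δ) (subst₂ (Adj G) (vertex-b i≤δ) (vertex-b j≤δ) e))
    ... | on-b i≤δ | on-a u = b-a-cyclic i≤δ j<L e
    ... | on-a u | on-b j≤δ = CyclicNeighbours-sym (b-a-cyclic j≤δ i<L (Adj-sym e))
    ... | on-a u | on-a u′ with A.chordless (suc u) (suc u′) (m<n⇒m<1+n (inner-a i<L)) (m<n⇒m<1+n (inner-a j<L))
                                  (subst₂ (Adj G) (vertex-a u) (vertex-a u′) e)
    ...   | inj₁ e′ = inj₁ (trans (sym (+-suc δ (suc u))) (cong (δ +_) e′))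
    ...   | inj₂ e′ = inj₂ (inj₁ (trans (sym (+-suc δ (suc u′))) (cong (δ +_) e′)))

    b-step : ∀ {i j} → i ≤ δ → j ≤ δ → suc i ≡ j → Adj G (vertex i) (vertex j)
    b-step i≤δ j≤δ refl = subst₂ (Adj G) (sym (vertex-b i≤δ)) (sym (vertex-b j≤δ)) (B.adjacent _ (s≤s j≤δ))

    a-step : ∀ {u u′} → suc (δ + suc u) ≡ δ + suc u′ → suc u′ < m →
      Adj G (vertex (δ + suc u)) (vertex (δ + suc u′))
    a-step {u} e u′<m with suc-injective (+-cancelˡ-≡ δ (suc (suc u)) _ (trans (+-suc δ (suc u)) e))
    ... | refl = subst₂ (Adj G) (sym (vertex-a u)) (sym (vertex-a (suc u))) (A.adjacent (suc u) (m<n⇒m<1+n u′<m))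

    b-a-step : ∀ {s u} → s ≤ δ → δ + suc u < L →
      CyclicNeighbours L s (δ + suc u) → Adj G (vertex s) (vertex (δ + suc u))
    b-a-step {u = u} s≤δ _ (inj₁ e) with suc-injective (trans e (+-suc δ u))
    ... | refl with n≤0⇒n≡0 (+-cancelˡ-≤ δ u 0 (subst (δ + u ≤_) (sym (+-identityʳ δ)) s≤δ))
    ...   | refl = subst₂ (Adj G) (trans a-0 (trans (cong b (sym (+-identityʳ δ))) (sym (vertex-b s≤δ))))
                              (sym (vertex-a 0)) (A.adjacent 0 (s≤s (<⇒≤ 2≤m)))
    b-a-step s≤δ _ (inj₂ (inj₁ e)) = ⊥-elim (<⇒≱ (s≤s (m≤m+n δ _)) (subst (_≤ δ) (sym e) s≤δ))
    b-a-step {u = u} s≤δ j<L (inj₂ (inj₂ (inj₁ (refl , e)))) =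
      subst₂ (Adj G) (sym (vertex-b s≤δ)) (sym (vertex-a u))
        (Adj-sym (subst (Adj G (a (suc u))) (trans (cong a u+2≡m) a-m) (A.adjacent (suc u) (s≤s (inner-a j<L)))))
      where
      u+2≡m : suc (suc u) ≡ m
      u+2≡m = +-cancelˡ-≡ δ (suc (suc u)) m (trans (+-suc δ (suc u)) e)
    b-a-step {u = u} _ _ (inj₂ (inj₂ (inj₂ (e , _)))) = ⊥-elim (0≢1+n (trans (sym e) (+-suc δ u)))

    cyclic⇒adj : ∀ i j → i < L → j < L → CyclicNeighbours L i j → Adj G (vertex i) (vertex j)
    cyclic⇒adj i j i<L j<L c with side i | side j
    ... | on-b i≤δ | on-b j≤δ = b-b i≤δ j≤δ c
      where
      short : ∀ {s} → s ≤ δ → suc s ≢ L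
      short s≤δ = <⇒≢ (≤-<-trans (s≤s s≤δ) δ+1<L)
      b-b : ∀ {i j} → i ≤ δ → j ≤ δ → CyclicNeighbours L i j → Adj G (vertex i) (vertex j)
      b-b i≤δ j≤δ (inj₁ e) = b-step i≤δ j≤δ e
      b-b i≤δ j≤δ (inj₂ (inj₁ e)) = Adj-sym (b-step j≤δ i≤δ e)
      b-b i≤δ j≤δ (inj₂ (inj₂ (inj₁ (_ , e)))) = ⊥-elim (short j≤δ e)
      b-b i≤δ j≤δ (inj₂ (inj₂ (inj₂ (_ , e)))) = ⊥-elim (short i≤δ e)
    ... | on-b i≤δ | on-a u = b-a-step i≤δ j<L c
    ... | on-a u | on-b j≤δ = Adj-sym (b-a-step j≤δ i<L (CyclicNeighbours-sym c))
    ... | on-a u | on-a u′ = a-a i<L j<L c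
      where
      a≢0 : ∀ {u} → δ + suc u ≢ 0
      a≢0 {u} e = 0≢1+n (trans (sym e) (+-suc δ u))
      a-a : ∀ {u u′} → δ + suc u < L → δ + suc u′ < L → CyclicNeighbours L (δ + suc u) (δ + suc u′) →
        Adj G (vertex (δ + suc u)) (vertex (δ + suc u′))
      a-a _ j<L (inj₁ e) = a-step e (inner-a j<L)
      a-a i<L _ (inj₂ (inj₁ e)) = Adj-sym (a-step e (inner-a i<L))
      a-a _ _ (inj₂ (inj₂ (inj₁ (e , _)))) = ⊥-elim (a≢0 e)
      a-a _ _ (inj₂ (inj₂ (inj₂ (e , _)))) = ⊥-elim (a≢0 e)

    -- CycConsec L i j unfolds to CyclicNeighbours L (toℕ i) (toℕ j).
    induced-cycle : InducedCycle G L (λ i → vertex (toℕ i))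
    induced-cycle = ≤-trans (s≤s (s≤s (s≤s z≤n))) (+-mono-≤ 2≤δ 2≤m)
                  , (λ {i} {j} e → toℕ-injective (injective _ _ (toℕ<n i) (toℕ<n j) e))
                  , λ i j → adj⇒cyclic _ _ (toℕ<n i) (toℕ<n j) , cyclic⇒adj _ _ (toℕ<n i) (toℕ<n j)

  detour⇒hole : ∀ {δ b T} → IsInducedPath (suc δ) b → 2 ≤ δ → Walk T (b δ) (b 0) →
    (∀ z → T z → ∀ s → 0 < s → s < δ → z ≢ b s × ¬ Adj G z (b s)) →
    ∃ λ k → δ + 2 ≤ k × ∃ λ c → InducedCycle G k c
  detour⇒hole {δ} b-path 2≤δ w T-apart with induced-subwalk w
  ... | w′ , w′-path = δ + len , +-monoʳ-≤ δ Cycle.2≤m , _ , Cycle.induced-cycle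
    where
    open Walk w′
    module Cycle = GluedCycle b-path w′-path 2≤δ at-0 at-len
                     (λ t 0<t t<len → T-apart (at t) (inner t 0<t t<len))

module OnInducedPath {n : ℕ} (G : Graph n) {q : ℕ} (3≤q : 3 ≤ q) (no-holes : NoLongHoles q G)
  {ℓ : ℕ} {v : ℕ → Fin n} (v-path : IsInducedPath G ℓ v) where

  private module V = IsInducedPath v-path

  D : ℕ
  D = q ∸ 2

  1≤D : 1 ≤ D
  1≤D = m+n≤o⇒m≤o∸n 1 3≤q

  OffPath : Fin n → Set
  OffPath x = ∀ k → k < ℓ → x ≢ v k

  Avoids : Fin n → ℕ → Set
  Avoids x k = x ≢ v k × ¬ Adj G x (v k)

  Far : Fin n → Set
  Far x = ∀ k → k < ℓ → Avoids x k

  -- The detour closes v i, …, v (i + δ) into an induced cycle of length at least δ + 2.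
  detour-bound : ∀ {i δ T x y} → 2 ≤ δ → i + δ < ℓ →
    Adj G (v (i + δ)) x → WalkIn G T x y → Adj G y (v i) →
    (∀ z → T z → ∀ k → i < k → k < i + δ → Avoids z k) → δ < D
  detour-bound {i} {δ} {T} 2≤δ i+δ<ℓ e₁ walk e₂ T-avoids =
    let k , δ+2≤k , c , hole = detour⇒hole G b-path 2≤δ (toWalk G e₁ walk e₂′) T-apart
    in m+n≤o⇒m≤o∸n (suc δ) (≤-trans (s≤s δ+2≤k) (≰⇒> λ q≤k → no-holes k q≤k c hole))
    where
    b-path : IsInducedPath G (suc δ) (λ s → v (i + s))
    b-path = IsInducedPath-drop G v-path i (subst (_≤ ℓ) (sym (+-suc i δ)) i+δ<ℓ)
    e₂′ : Adj G _ (v (i + 0))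
    e₂′ = subst (λ z → Adj G _ (v z)) (sym (+-identityʳ i)) e₂
    T-apart : ∀ z → T z → ∀ s → 0 < s → s < δ → z ≢ v (i + s) × ¬ Adj G z (v (i + s))
    T-apart z Tz s 0<s s<δ =
      T-avoids z Tz (i + s) (subst (_< i + s) (+-identityʳ i) (+-monoʳ-< i 0<s)) (+-monoʳ-< i s<δ)

  at-most-D : ∀ δ → (2 ≤ δ → δ < D) → δ ≤ D
  at-most-D zero _ = z≤n
  at-most-D (suc zero) _ = 1≤D
  at-most-D (suc (suc δ)) bound = <⇒≤ (bound (s≤s (s≤s z≤n)))

  neighbour-gap : ∀ {x f e} → OffPath x → f < e → e < ℓ → Adj G x (v f) → Adj G x (v e) →
    (∀ k → f < k → k < e → ¬ Adj G x (v k)) → e ≤ f + D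
  neighbour-gap {x} {f} x-off f<e e<ℓ x∼f x∼e none with m≤n⇒∃[o]m+o≡n (<⇒≤ f<e)
  ... | δ , refl =
    +-monoʳ-≤ f (at-most-D δ λ 2≤δ → detour-bound 2≤δ e<ℓ (Adj-sym G x∼e) (here refl) x∼f avoids)
    where
    avoids : ∀ z → z ≡ x → ∀ k → f < k → k < f + δ → Avoids z k
    avoids _ refl k f<k k<e = x-off k (<-trans k<e e<ℓ) , none k f<k k<e

  first-neighbour : ∀ {x k} → Adj G x (v k) →
    ∃ λ α → Adj G x (v α) × (∀ t → t < α → ¬ Adj G x (v t))
  first-neighbour x∼k with least-in (λ t → adj? G _ (v t)) z≤n x∼k
  ... | α , _ , _ , x∼α , before = α , x∼α , λ t → before t z≤n

  Linked : Fin n → Fin n → Set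
  Linked x y = ∃₂ λ u w → Adj G x u × WalkIn G Far u w × Adj G w y

  Linked-sym : ∀ {x y} → Linked x y → Linked y x
  Linked-sym (u , w , x∼u , walk , w∼y) = w , u , Adj-sym G w∼y , reverse-walk G walk , Adj-sym G x∼u

  -- The last neighbour of x up to k′ and the next neighbour of y after it span
  -- a segment of P which the walk from y to x closes into a hole.
  linked-neighbours-meet : ∀ {x y k k′} → OffPath x → OffPath y → Linked y x → k ≤ k′ → k′ < ℓ →
    Adj G x (v k) → Adj G y (v k′) →
    ∃₂ λ i j → Adj G x (v i) × Adj G y (v j) × i ≤ j × j ≤ i + D × j < ℓ
  linked-neighbours-meet {x} {y} x-off y-off (u , w , y∼u , walk , w∼x) k≤k′ k′<ℓ x∼k y∼k′
    with greatest-in (λ t → adj? G x (v t)) k≤k′ x∼k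
  ... | i , _ , i≤k′ , x∼i , x-after with least-in (λ t → adj? G y (v t)) i≤k′ y∼k′
  ...   | j , i≤j , j≤k′ , y∼j , y-before with m≤n⇒∃[o]m+o≡n i≤j
  ...     | δ , refl = i , i + δ , x∼i , y∼j , i≤j , +-monoʳ-≤ i (at-most-D δ bound) , j<ℓ
    where
    j<ℓ : i + δ < ℓ
    j<ℓ = ≤-<-trans j≤k′ k′<ℓ
    T : Fin n → Set
    T z = ∀ k → i < k → k < i + δ → Avoids z k
    T-y : T y
    T-y k i<k k<j = y-off k (<-trans k<j j<ℓ) , y-before k (<⇒≤ i<k) k<j
    T-x : T x
    T-x k i<k k<j = x-off k (<-trans k<j j<ℓ) , x-after k i<k (≤-trans (<⇒≤ k<j) j≤k′)
    Far⇒T : Far ⊆ T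
    Far⇒T z far k _ k<j = far k (<-trans k<j j<ℓ)
    bound : 2 ≤ δ → δ < D
    bound 2≤δ = detour-bound 2≤δ j<ℓ (Adj-sym G y∼j)
      (step T-y y∼u (snoc-walk G (map-walk G Far⇒T walk) w∼x T-x)) x∼i (λ _ Tz → Tz)

  Close : Fin n → Fin n → Set
  Close x y = ∃₂ λ i j → i < ℓ × j < ℓ × Adj G x (v i) × Adj G y (v j) × j ≤ i + D × i ≤ j + D

  linked-neighbours-close : ∀ {x y k k′} → OffPath x → OffPath y → Linked x y → k < ℓ → k′ < ℓ →
    Adj G x (v k) → Adj G y (v k′) → Close x y
  linked-neighbours-close {k = k} {k′} x-off y-off link k<ℓ k′<ℓ x∼k y∼k′ with ≤-total k k′
  ... | inj₁ k≤k′ =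
    let i , j , x∼i , y∼j , i≤j , j≤i+D , j<ℓ =
          linked-neighbours-meet x-off y-off (Linked-sym link) k≤k′ k′<ℓ x∼k y∼k′
    in i , j , ≤-<-trans i≤j j<ℓ , j<ℓ , x∼i , y∼j , j≤i+D , ≤-trans i≤j (m≤m+n j D)
  ... | inj₂ k′≤k =
    let i , j , y∼i , x∼j , i≤j , j≤i+D , j<ℓ = linked-neighbours-meet y-off x-off link k′≤k k<ℓ y∼k′ x∼k
    in j , i , j<ℓ , ≤-<-trans i≤j j<ℓ , x∼j , y∼i , ≤-trans i≤j (m≤m+n j D) , j≤i+D

  record Spread (x : Fin n) (b r : ℕ) : Set where
    field
      pick       : ℕ → ℕ
      pick-adj   : ∀ u → u ≤ r → Adj G x (v (pick u))
      pick-≤     : ∀ u → u ≤ r → pick u ≤ b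
      pick-apart : ∀ u w → u < w → w ≤ r → 2 + pick u ≤ pick w

  no-large-spread : ∀ {x b r} → K1Free (suc r) G → OffPath x → b < ℓ → ¬ Spread x b r
  no-large-spread {x} {b} {r} claw-free x-off b<ℓ σ =
    claw-free (x , leaf , leaf-injective , (λ z → pick-adj _ (index≤ z)) , leaf≢x , leaves-apart)
    where
    open Spread σ
    index≤ : ∀ (z : Fin (suc r)) → toℕ z ≤ r
    index≤ z = s≤s⁻¹ (toℕ<n z)
    leaf : Fin (suc r) → Fin n
    leaf z = v (pick (toℕ z))
    on-path : ∀ z → pick (toℕ z) < ℓ
    on-path z = ≤-<-trans (pick-≤ _ (index≤ z)) b<ℓ
    pick-injective : ∀ u w → u ≤ r → w ≤ r → pick u ≡ pick w → u ≡ w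
    pick-injective u w u≤r w≤r e with <-cmp u w
    ... | tri< u<w _ _ = ⊥-elim (<-irrefl e (≤-trans (n≤1+n _) (pick-apart u w u<w w≤r)))
    ... | tri≈ _ u≡w _ = u≡w
    ... | tri> _ _ w<u = ⊥-elim (<-irrefl (sym e) (≤-trans (n≤1+n _) (pick-apart w u w<u u≤r)))
    not-consecutive : ∀ u w → u ≤ r → w ≤ r → suc (pick u) ≢ pick w
    not-consecutive u w u≤r w≤r e with <-cmp u w
    ... | tri< u<w _ _ = <-irrefl e (pick-apart u w u<w w≤r)
    ... | tri≈ _ refl _ = <-irrefl (sym e) (n<1+n _)
    ... | tri> _ _ w<u = <-asym (subst (pick u <_) e (n<1+n _)) (≤-trans (n≤1+n _) (pick-apart w u w<u u≤r))
    leaf-injective : ∀ {z w} → leaf z ≡ leaf w → z ≡ w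
    leaf-injective {z} {w} e =
      toℕ-injective (pick-injective _ _ (index≤ z) (index≤ w) (V.injective _ _ (on-path z) (on-path w) e))
    leaf≢x : ∀ z → leaf z ≢ x
    leaf≢x z e = x-off _ (on-path z) (sym e)
    leaves-apart : ∀ z w → ¬ Adj G (leaf z) (leaf w)
    leaves-apart z w e with V.chordless _ _ (on-path z) (on-path w) e
    ... | inj₁ e′ = not-consecutive _ _ (index≤ z) (index≤ w) e′
    ... | inj₂ e′ = not-consecutive _ _ (index≤ w) (index≤ z) e′

  singleton-spread : ∀ {x a b} → a ≤ b → Adj G x (v a) → Spread x b 0
  singleton-spread {a = a} a≤b x∼a = record
    { pick = λ _ → a ; pick-adj = λ _ _ → x∼a ; pick-≤ = λ _ _ → a≤b
    ; pick-apart = λ u w u<w w≤0 → ⊥-elim (<⇒≱ (<-≤-trans u<w w≤0) z≤n) }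

  -- Greedy step: the first neighbour beyond pick r + 1 lies within D + 1 of pick r,
  -- since the last neighbour before it is at most pick r + 1.
  spread-extend : ∀ {x a b r} → OffPath x → b < ℓ → (σ : Spread x b r) →
    Spread.pick σ r ≤ a + r * suc D → 2 + Spread.pick σ r ≤ b → Adj G x (v b) →
    Σ (Spread x b (suc r)) λ σ′ → Spread.pick σ′ (suc r) ≤ a + suc r * suc D
  spread-extend {x} {a} {b} {r} x-off b<ℓ σ last≤ room x∼b
    with least-in (λ t → adj? G x (v t)) room x∼b
  ... | suc e′ , s≤s last+1≤e′ , e≤b , x∼e , none-before
    with greatest-in (λ t → adj? G x (v t)) (<⇒≤ last+1≤e′) (Spread.pick-adj σ r ≤-refl)
  ...   | f , _ , f≤e′ , x∼f , none-after = σ′ , subst (_≤ _) (sym pick′-last) e≤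
    where
    open Spread σ
    f≤last+1 : f ≤ suc (pick r)
    f≤last+1 = ≮⇒≥ λ last+1<f → none-before f last+1<f (s≤s f≤e′) x∼f
    e≤f+D : suc e′ ≤ f + D
    e≤f+D = neighbour-gap x-off (s≤s f≤e′) (≤-<-trans e≤b b<ℓ) x∼f x∼e
              (λ k f<k k<e → none-after k f<k (s≤s⁻¹ k<e))
    e≤ : suc e′ ≤ a + suc r * suc D
    e≤ = begin
      suc e′                   ≤⟨ e≤f+D ⟩
      f + D                    ≤⟨ +-monoˡ-≤ D f≤last+1 ⟩
      suc (pick r + D)         ≤⟨ s≤s (+-monoˡ-≤ D last≤) ⟩
      suc (a + r * suc D + D)  ≡⟨ regroup a (r * suc D) D ⟩
      a + suc r * suc D        ∎
      where
      open ≤-Reasoning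
      regroup : ∀ a rs D → suc (a + rs + D) ≡ a + (suc D + rs)
      regroup = solve-∀
    pick′ : ℕ → ℕ
    pick′ u with u ≤? r
    ... | yes _ = pick u
    ... | no _ = suc e′
    pick′-last : pick′ (suc r) ≡ suc e′
    pick′-last with suc r ≤? r
    ... | yes r<r = ⊥-elim (<-irrefl refl r<r)
    ... | no _ = refl
    σ′ : Spread x b (suc r)
    σ′ = record { pick = pick′ ; pick-adj = adj′ ; pick-≤ = ≤b′ ; pick-apart = apart′ }
      where
      adj′ : ∀ u → u ≤ suc r → Adj G x (v (pick′ u))
      adj′ u _ with u ≤? r
      ... | yes u≤r = pick-adj u u≤r
      ... | no _ = x∼e
      ≤b′ : ∀ u → u ≤ suc r → pick′ u ≤ b
      ≤b′ u _ with u ≤? r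
      ... | yes u≤r = pick-≤ u u≤r
      ... | no _ = e≤b
      last-max : ∀ u → u ≤ r → pick u ≤ pick r
      last-max u u≤r with m≤n⇒m<n∨m≡n u≤r
      ... | inj₁ u<r = ≤-trans (n≤1+n _) (≤-trans (n≤1+n _) (pick-apart u r u<r ≤-refl))
      ... | inj₂ refl = ≤-refl
      apart′ : ∀ u w → u < w → w ≤ suc r → 2 + pick′ u ≤ pick′ w
      apart′ u w u<w w≤ with w ≤? r | u ≤? r
      ... | yes w≤r | yes _ = pick-apart u w u<w w≤r
      ... | yes w≤r | no u≰r = ⊥-elim (u≰r (≤-trans (<⇒≤ u<w) w≤r))
      ... | no _ | yes u≤r = ≤-trans (s≤s (s≤s (last-max u u≤r))) (s≤s last+1≤e′)
      ... | no _ | no u≰r = ⊥-elim (u≰r (s≤s⁻¹ (≤-trans u<w w≤)))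

  spread-or-bounded : ∀ {x a b} → OffPath x → a ≤ b → b < ℓ → Adj G x (v a) → Adj G x (v b) →
    ∀ r → b ≤ suc (a + r * suc D) ⊎ Σ (Spread x b r) λ σ → Spread.pick σ r ≤ a + r * suc D
  spread-or-bounded {a = a} _ a≤b _ x∼a _ zero = inj₂ (singleton-spread a≤b x∼a , m≤m+n a 0)
  spread-or-bounded {a = a} {b} x-off a≤b b<ℓ x∼a x∼b (suc r)
    with spread-or-bounded x-off a≤b b<ℓ x∼a x∼b r
  ... | inj₁ b≤ = inj₁ (≤-trans b≤ (s≤s (+-monoʳ-≤ a (m≤n+m (r * suc D) (suc D)))))
  ... | inj₂ (σ , last≤) with 2 + Spread.pick σ r ≤? b
  ...   | yes room = inj₂ (spread-extend x-off b<ℓ σ last≤ room x∼b)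
  ...   | no no-room = inj₁ (≤-trans (s≤s⁻¹ (≰⇒> no-room))
                                (s≤s (≤-trans last≤ (+-monoʳ-≤ a (m≤n+m (r * suc D) (suc D))))))

  Span : ℕ → ℕ
  Span d = suc (d * suc D)

  neighbour-span : ∀ {d x a b} → K1Free (suc d) G → OffPath x → a ≤ b → b < ℓ →
    Adj G x (v a) → Adj G x (v b) → b ≤ a + Span d
  neighbour-span {d} {a = a} {b} claw-free x-off a≤b b<ℓ x∼a x∼b
    with spread-or-bounded x-off a≤b b<ℓ x∼a x∼b d
  ... | inj₁ b≤ = subst (b ≤_) (sym (+-suc a (d * suc D))) b≤
  ... | inj₂ (σ , _) = ⊥-elim (no-large-spread claw-free x-off b<ℓ σ)

  neighbour-range : ∀ {d x y α} → K1Free (suc d) G → OffPath x → Adj G x (v α) →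
    (∀ t → t < α → ¬ Adj G x (v t)) → Close x y →
    ∃ λ j → j < ℓ × Adj G y (v j) × α ∸ D ≤ j × j ≤ α + Span d + D
  neighbour-range {d} {α = α} claw-free x-off x∼α before
                  (i , j , i<ℓ , j<ℓ , x∼i , y∼j , j≤i+D , i≤j+D) =
    j , j<ℓ , y∼j , lower , upper
    where
    α≤i : α ≤ i
    α≤i = ≮⇒≥ λ i<α → before i i<α x∼i
    lower : α ∸ D ≤ j
    lower = m≤n+o⇒m∸n≤o α D (≤-trans α≤i (subst (i ≤_) (+-comm j D) i≤j+D))
    upper : j ≤ α + Span d + D
    upper = ≤-trans j≤i+D (+-monoˡ-≤ D (neighbour-span claw-free x-off α≤i i<ℓ x∼α x∼i))

  range-fits : ∀ α d {h} → 2 * d * D + 2 * q ≤ h → α + Span d + D < α ∸ D + h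
  range-fits α d {h} budget = begin-strict
    α + Span d + D             ≤⟨ +-monoˡ-≤ D (+-monoˡ-≤ (Span d) (m≤n+m∸n α D)) ⟩
    D + (α ∸ D) + Span d + D   ≡⟨ regroup D (α ∸ D) (Span d) ⟩
    α ∸ D + (D + Span d + D)   <⟨ +-monoʳ-< (α ∸ D) (≤-trans (span-budget d q 3≤q) budget) ⟩
    α ∸ D + h                  ∎
    where
    open ≤-Reasoning
    regroup : ∀ D A S → D + A + S + D ≡ A + (D + S + D)
    regroup = solve-∀
    span-budget : ∀ d q → 3 ≤ q →
      suc (q ∸ 2 + suc (d * suc (q ∸ 2)) + (q ∸ 2)) ≤ 2 * d * (q ∸ 2) + 2 * q
    span-budget d (suc (suc (suc r))) _ = ≤-trans (m≤m+n _ (d * r + 2)) (≤-reflexive (slack d r))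
      where
      slack : ∀ d r → suc (suc r + suc (d * suc (suc r)) + suc r) + (d * r + 2)
                      ≡ 2 * d * suc r + 2 * suc (suc (suc r))
      slack = solve-∀
    span-budget _ (suc zero) (s≤s ())
    span-budget _ (suc (suc zero)) (s≤s (s≤s ()))

window-covering : ∀ {A B ℓ h} → h ≤ ℓ → B < A + h →
  ∃ λ s → s ≤ ℓ ∸ h × (∀ k → A ≤ k → k ≤ B → k < ℓ → s ≤ k × k < s + h)
window-covering {A} {ℓ = ℓ} {h} h≤ℓ B<A+h with ≤-total A (ℓ ∸ h)
... | inj₁ A≤ℓ∸h = A , A≤ℓ∸h , λ k A≤k k≤B _ → A≤k , ≤-<-trans k≤B B<A+h
... | inj₂ ℓ∸h≤A =
  ℓ ∸ h , ≤-refl , λ k A≤k _ k<ℓ → ≤-trans ℓ∸h≤A A≤k , subst (k <_) (sym (m∸n+n≡m h≤ℓ)) k<ℓ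

module Component {n : ℕ} (G : Graph n) {X H : VSet n} (X? : ∀ z → Dec (X z))
  (H-comp : ComponentOfMinus G X H) where

  H⊆¬X : H ⊆ λ z → ¬ X z
  H⊆¬X = proj₁ H-comp

  H-inhabited : ∃ H
  H-inhabited = proj₁ (proj₁ (proj₂ H-comp))

  H-walk : ∀ {u w} → H u → H w → WalkIn G H u w
  H-walk Hu Hw = proj₂ (proj₁ (proj₂ H-comp)) _ _ Hu Hw

  absorbs : ∀ {u z} → H u → Adj G u z → ¬ X z → H z
  absorbs {u} {z} Hu u∼z ¬Xz =
    proj₂ (proj₂ H-comp) H′ (λ _ → inj₁) H′⊆¬X ((z , inj₂ refl) , H′-walk) z (inj₂ refl)
    where
    H′ : VSet n
    H′ w = H w ⊎ w ≡ z
    H′⊆¬X : H′ ⊆ λ w → ¬ X w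
    H′⊆¬X w (inj₁ Hw) = H⊆¬X w Hw
    H′⊆¬X _ (inj₂ refl) = ¬Xz
    into-H′ : ∀ {a b} → WalkIn G H a b → WalkIn G H′ a b
    into-H′ = map-walk G (λ _ → inj₁)
    to-z : ∀ {a} → H a → WalkIn G H′ a z
    to-z Ha = snoc-walk G (into-H′ (H-walk Ha Hu)) u∼z (inj₂ refl)
    H′-walk : ∀ a b → H′ a → H′ b → WalkIn G H′ a b
    H′-walk _ _ (inj₁ Ha) (inj₁ Hb) = into-H′ (H-walk Ha Hb)
    H′-walk _ _ (inj₁ Ha) (inj₂ refl) = to-z Ha
    H′-walk _ _ (inj₂ refl) (inj₁ Hb) = reverse-walk G (to-z Hb)
    H′-walk _ _ (inj₂ refl) (inj₂ refl) = here (inj₂ refl)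

  boundary⊆X : N G H ⊆ X
  boundary⊆X y (¬Hy , u , Hu , u∼y) with X? y
  ... | yes Xy = Xy
  ... | no ¬Xy = ⊥-elim (¬Hy (absorbs Hu u∼y ¬Xy))

  boundary-nonempty : ∀ {S u z} → H u → X z → WalkIn G S u z → ∃ (N G H)
  boundary-nonempty Hu Xz (here _) = ⊥-elim (H⊆¬X _ Hu Xz)
  boundary-nonempty Hu Xz (step {v = w} _ u∼w walk) with X? w
  ... | yes Xw = w , (λ Hw → H⊆¬X w Hw Xw) , _ , Hu , u∼w
  ... | no ¬Xw = boundary-nonempty (absorbs Hu u∼w ¬Xw) Xz walk

  boundary-walk : ∀ {x y} → N G H x → N G H y → ∃₂ λ u w → Adj G x u × WalkIn G H u w × Adj G w y
  boundary-walk (_ , u , Hu , u∼x) (_ , w , Hw , w∼y) = u , w , Adj-sym G u∼x , H-walk Hu Hw , w∼y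

module _ {n ℓ : ℕ} (p : Fin ℓ → Fin n) (z : Fin n) where

  -- p read as a sequence on ℕ; z is a junk value at positions ≥ ℓ.
  extend : ℕ → Fin n
  extend k with k <? ℓ
  ... | yes k<ℓ = p (fromℕ< k<ℓ)
  ... | no _ = z

  extend-fromℕ< : ∀ {k} (k<ℓ : k < ℓ) → extend k ≡ p (fromℕ< k<ℓ)
  extend-fromℕ< {k} k<ℓ with k <? ℓ
  ... | yes _ = refl
  ... | no k≮ℓ = ⊥-elim (k≮ℓ k<ℓ)

  extend-toℕ : ∀ j → extend (toℕ j) ≡ p j
  extend-toℕ j = trans (extend-fromℕ< (toℕ<n j)) (cong p (fromℕ<-toℕ j _))

  extend-induced : ∀ {G : Graph n} → InducedPath G ℓ p → IsInducedPath G ℓ extend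
  extend-induced {G} (p-injective , p-adj) = record
    { adjacent = adjacent ; injective = injective ; chordless = chordless }
    where
    index : ∀ {k} (k<ℓ : k < ℓ) → toℕ (fromℕ< k<ℓ) ≡ k
    index k<ℓ = toℕ-fromℕ< k<ℓ
    adjacent : ∀ k → suc k < ℓ → Adj G (extend k) (extend (suc k))
    adjacent k k+1<ℓ = subst₂ (Adj G) (sym (extend-fromℕ< k<ℓ)) (sym (extend-fromℕ< k+1<ℓ))
      (proj₂ (p-adj _ _) (inj₁ (trans (cong suc (index k<ℓ)) (sym (index k+1<ℓ)))))
      where
      k<ℓ : k < ℓ
      k<ℓ = <-trans (n<1+n k) k+1<ℓ
    injective : ∀ i j → i < ℓ → j < ℓ → extend i ≡ extend j → i ≡ j
    injective i j i<ℓ j<ℓ e = trans (sym (index i<ℓ)) (trans (cong toℕ (p-injective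
      (trans (sym (extend-fromℕ< i<ℓ)) (trans e (extend-fromℕ< j<ℓ))))) (index j<ℓ))
    chordless : ∀ i j → i < ℓ → j < ℓ → Adj G (extend i) (extend j) → suc i ≡ j ⊎ suc j ≡ i
    chordless i j i<ℓ j<ℓ e
      with proj₁ (p-adj _ _) (subst₂ (Adj G) (extend-fromℕ< i<ℓ) (extend-fromℕ< j<ℓ) e)
    ... | inj₁ e′ = inj₁ (trans (cong suc (sym (index i<ℓ))) (trans e′ (index j<ℓ)))
    ... | inj₂ e′ = inj₂ (trans (cong suc (sym (index j<ℓ))) (trans e′ (index i<ℓ)))

closed-neighbourhood? : ∀ {n ℓ} (G : Graph n) (p : Fin ℓ → Fin n) → ∀ z → Dec (N[ G ] (PathVerts p) z)
closed-neighbourhood? G p z = on-path? z ⊎-dec (¬? (on-path? z) ×-dec any? λ u → on-path? u ×-dec adj? G u z)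
  where
  on-path? : ∀ z → Dec (PathVerts p z)
  on-path? z = any? λ j → p j ≟ᶠ z

module PathComponent {n ℓ : ℕ} (G : Graph n) {p : Fin ℓ → Fin n} (z : Fin n) (p-path : InducedPath G ℓ p)
  {q : ℕ} (3≤q : 3 ≤ q) (no-holes : NoLongHoles q G)
  {H : VSet n} (H-comp : ComponentOfMinus G (N[ G ] (PathVerts p)) H) where

  v : ℕ → Fin n
  v = extend p z

  open OnInducedPath G 3≤q no-holes (extend-induced p z p-path) public
  open Component G (closed-neighbourhood? G p) H-comp public

  on-path : ∀ {k} → k < ℓ → PathVerts p (v k)
  on-path k<ℓ = fromℕ< k<ℓ , sym (extend-fromℕ< p z k<ℓ)

  H⊆Far : H ⊆ Far
  H⊆Far w Hw k k<ℓ = (λ w≡vk → ¬X (inj₁ (subst (PathVerts p) (sym w≡vk) (on-path k<ℓ))))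
                    , λ w∼vk → ¬X (inj₂ ((λ w∈P → ¬X (inj₁ w∈P)) , v k , on-path k<ℓ , Adj-sym G w∼vk))
    where
    ¬X = H⊆¬X w Hw

  boundary∉path : ∀ {y} → N G H y → ¬ PathVerts p y
  boundary∉path (_ , u , Hu , u∼y) y∈P =
    H⊆¬X u Hu (inj₂ ((λ u∈P → H⊆¬X u Hu (inj₁ u∈P)) , _ , y∈P , Adj-sym G u∼y))

  boundary-off-path : ∀ {y} → N G H y → OffPath y
  boundary-off-path y∈∂H k k<ℓ y≡vk = boundary∉path y∈∂H (subst (PathVerts p) (sym y≡vk) (on-path k<ℓ))

  boundary-touches-path : ∀ {y} → N G H y → ∃ λ k → k < ℓ × Adj G y (v k)
  boundary-touches-path {y} y∈∂H with boundary⊆X y y∈∂H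
  ... | inj₁ y∈P = ⊥-elim (boundary∉path y∈∂H y∈P)
  ... | inj₂ (_ , u , (j , pj≡u) , u∼y) =
    toℕ j , toℕ<n j , Adj-sym G (subst (λ w → Adj G w y) (sym (trans (extend-toℕ p z j) pj≡u)) u∼y)

  boundary-close : ∀ {x y} → N G H x → N G H y → Close x y
  boundary-close x∈∂H y∈∂H
    with boundary-touches-path x∈∂H | boundary-touches-path y∈∂H | boundary-walk x∈∂H y∈∂H
  ... | k , k<ℓ , x∼k | k′ , k′<ℓ , y∼k′ | u , w , x∼u , walk , w∼y =
    linked-neighbours-close (boundary-off-path x∈∂H) (boundary-off-path y∈∂H)
      (u , w , x∼u , map-walk G H⊆Far walk , w∼y) k<ℓ k′<ℓ x∼k y∼k′

  BoundaryTouches : ℕ → ℕ → Set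
  BoundaryTouches s h = ∀ {y} → N G H y → ∃ λ j → j < ℓ × Adj G y (v j) × s ≤ j × j < s + h

  boundary-in-window : ∀ {d h} → K1Free (suc d) G → 2 * d * D + 2 * q ≤ h → h ≤ ℓ → ∃ (N G H) →
    ∃ λ s → s ≤ ℓ ∸ h × BoundaryTouches s h
  boundary-in-window {d} claw-free budget h≤ℓ (x , x∈∂H)
    with first-neighbour (proj₂ (proj₂ (boundary-touches-path x∈∂H)))
  ... | α , x∼α , before with window-covering h≤ℓ (range-fits α d budget)
  ...   | s , s≤ℓ∸h , covers = s , s≤ℓ∸h , λ y∈∂H →
    let j , j<ℓ , y∼j , lower , upper = neighbour-range claw-free (boundary-off-path x∈∂H) x∼α before
                                          (boundary-close x∈∂H y∈∂H)
        s≤j , j<s+h = covers j lower upper j<ℓ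
    in j , j<ℓ , y∼j , s≤j , j<s+h

window-neighbour : ∀ {n ℓ} (G : Graph n) (p : Fin ℓ → Fin n) (h : ℕ) {m s} (s<m : s < m)
  {y j} (j<ℓ : j < ℓ) →
  ¬ PathVerts p y → s ≤ j → j < s + h → Adj G (p (fromℕ< j<ℓ)) y → β G p h (fromℕ< s<m) y
window-neighbour G p h s<m j<ℓ y∉P s≤j j<s+h pj∼y =
  inj₂ ( (λ (j′ , _ , _ , pj′≡y) → y∉P (j′ , pj′≡y))
       , p (fromℕ< j<ℓ)
       , (fromℕ< j<ℓ , subst₂ _≤_ (sym (toℕ-fromℕ< s<m)) (sym (toℕ-fromℕ< j<ℓ)) s≤j
                     , subst₂ (λ a b → a < b + h) (sym (toℕ-fromℕ< j<ℓ)) (sym (toℕ-fromℕ< s<m)) j<s+h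
                     , refl )
       , pj∼y )

lemma4p8 : (d q : ℕ) → 1 ≤ d → 3 ≤ q →
    {n : ℕ} (G : Graph n) → Connected G → K1Free d G → NoLongHoles q G →
    (h : ℕ) → 2 * (d ∸ 1) * (q ∸ 2) + 2 * q ≤ h →
    (ℓ : ℕ) (p : Fin ℓ → Fin n) → InducedPath G ℓ p → h ≤ ℓ →
    (H : VSet n) → ComponentOfMinus G (N[ G ] (PathVerts p)) H →
    ∃ λ (b : Fin (ℓ ∸ h + 1)) → N G H ⊆ β G p h b
lemma4p8 (suc d) q _ 3≤q G connected claw-free no-holes h budget ℓ p p-path h≤ℓ H H-comp =
  conclude (boundary-in-window claw-free budget h≤ℓ ∂H-inhabited)
  where
  0<ℓ : 0 < ℓ
  0<ℓ = ≤-trans (≤-trans z<s 3≤q)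
          (≤-trans (m≤m+n q (q + 0)) (≤-trans (m≤n+m (2 * q) (2 * d * (q ∸ 2))) (≤-trans budget h≤ℓ)))
  open PathComponent G (p (fromℕ< 0<ℓ)) p-path 3≤q no-holes H-comp
  ∂H-inhabited : ∃ (N G H)
  ∂H-inhabited = boundary-nonempty (proj₂ H-inhabited) (inj₁ (on-path 0<ℓ)) (proj₂ connected _ _ tt tt)
  conclude : (∃ λ s → s ≤ ℓ ∸ h × BoundaryTouches s h) → ∃ λ (b : Fin (ℓ ∸ h + 1)) → N G H ⊆ β G p h b
  conclude (s , s≤ℓ∸h , covered) = fromℕ< s<ℓ∸h+1 , λ y y∈∂H →
    let j , j<ℓ , y∼j , s≤j , j<s+h = covered y∈∂H
    in window-neighbour G p h s<ℓ∸h+1 j<ℓ (boundary∉path y∈∂H) s≤j j<s+h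
         (subst (λ w → Adj G w y) (extend-fromℕ< p _ j<ℓ) (Adj-sym G y∼j))
    where
    s<ℓ∸h+1 : s < ℓ ∸ h + 1
    s<ℓ∸h+1 = subst (s <_) (+-comm 1 (ℓ ∸ h)) (s≤s s≤ℓ∸h)
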